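{- Let $0\le f(n)\le n$ be an integer sequence. Its average order is bounded and positive if and only if there exists an integer sequence $N_t=k^t$, with $k>1$, and constants $0<a'<b'$ such that the block-sums $F_t:=\sum_{n\in(N_t,N_{t+1}]}f(n)$ satisfy $a'N_{t+1}\le F_t\le b'N_t$ for all sufficiently large $t$. Furthermore, $k$ can be chosen large enough that there exists some $\lambda\in(0,1)$ with $F_t\le\lambda F_{t+1}$ for all sufficiently large $t$.
   Context: "Average order positive and bounded" means there are constants $0<a<b$ with $aN\le\sum_{n=1}^N f(n)\le bN$ for all sufficiently large $N$.
   Formalization: The constants a, b, a′, b′ and λ are taken in the rationals. -}

module Defs where

open import Data.Nat using (ℕ; zero; suc; _+_; _∸_; _^_)
open import Data.Integer using (+_)
open import Data.Rational using (ℚ; _/_)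

toℚ : ℕ → ℚ
toℚ n = + n / 1

S : (ℕ → ℕ) → ℕ → ℕ
S f zero    = 0
S f (suc N) = S f N + f (suc N)

blockFrom : (ℕ → ℕ) → ℕ → ℕ → ℕ
blockFrom f m zero      = 0
blockFrom f m (suc len) = blockFrom f m len + f (m + suc len)

-- F_t = Σ_{n ∈ (k^t, k^(t+1)]} f n   (N_t = k^t)
F : (ℕ → ℕ) → ℕ → ℕ → ℕ
F f k t = blockFrom f (k ^ t) (k ^ suc t ∸ k ^ t)

module Submission where

-- The key identity is
-- S(k^(t+1)) = S(k^t) + F_t.  Forward: if k ≥ 4·D·B then S(k^t) ≤ B·k^t is at most half of
-- k^(t+1)/D, so F_t carries the rest of S(k^(t+1)) ≥ k^(t+1)/D, and F_t ≤ S(k^(t+1)) ≤ B·k^(t+1);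
-- comparing consecutive blocks gives doubling.  Backward: summing F_t ≤ B·k^t gives
-- S(k^t) ≤ C + B·k^t, and placing N between consecutive powers of k bounds S N by multiples of N.

module BlockSums where
  open import Defs
  open import Data.Nat
  open import Data.Nat.Properties
  open import Data.Nat.Tactic.RingSolver using (solve-∀)
  open import Data.Product using (Σ; _×_; _,_; proj₁; proj₂)
  open import Relation.Binary.PropositionalEquality
  open import Relation.Nullary using (yes; no)
  open import Relation.Nullary.Negation using (contradiction)

  Eventually : (ℕ → Set) → Set
  Eventually P = Σ ℕ λ N₀ → ∀ N → N ≥ N₀ → P N

  NatBounds : (X Y V : ℕ → ℕ) → Set
  NatBounds X Y V = Σ ℕ λ d → Σ ℕ λ B → Eventually λ N → X N ≤ suc d * Y N × Y N ≤ B * V N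

  absorb-half : ∀ a b c → a ≤ b + c → 2 * b ≤ a → a ≤ 2 * c
  absorb-half a b c a≤b+c 2b≤a = +-cancelˡ-≤ a a (2 * c) (begin
    a + a          ≡⟨ cong (a +_) (sym (+-identityʳ a)) ⟩
    2 * a          ≤⟨ *-monoʳ-≤ 2 a≤b+c ⟩
    2 * (b + c)    ≡⟨ *-distribˡ-+ 2 b c ⟩
    2 * b + 2 * c  ≤⟨ +-monoˡ-≤ (2 * c) 2b≤a ⟩
    a + 2 * c      ∎)
    where open ≤-Reasoning

  n<k^n : ∀ k → 1 < k → ∀ n → n < k ^ n
  n<k^n k 1<k zero    = z<s
  n<k^n k 1<k (suc n) = <-≤-trans (s<s (n<k^n k 1<k n)) (^-monoʳ-< k 1<k (n<1+n n))

  bracket : (g : ℕ → ℕ) (N : ℕ) → ∀ fuel m → g m ≤ N → N < g (fuel + m) →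
            Σ ℕ λ e → m ≤ e × g e ≤ N × N < g (suc e)
  bracket g N zero       m lo hi = contradiction lo (<⇒≱ hi)
  bracket g N (suc fuel) m lo hi with N <? g (suc m)
  ... | yes N<next = m , ≤-refl , lo , N<next
  ... | no  N≮next with bracket g N fuel (suc m) (≮⇒≥ N≮next) (subst (λ z → N < g z) (sym (+-suc fuel m)) hi)
  ... | e , m<e , found = e , <⇒≤ m<e , found

  module _ (f : ℕ → ℕ) where

    S-split : ∀ m len → S f (m + len) ≡ S f m + blockFrom f m len
    S-split m zero      rewrite +-identityʳ m = sym (+-identityʳ (S f m))
    S-split m (suc len) rewrite +-suc m len | S-split m len = +-assoc (S f m) _ _

    S-mono : ∀ {m n} → m ≤ n → S f m ≤ S f n
    S-mono {m} {n} m≤n = begin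
      S f m                          ≤⟨ m≤m+n _ _ ⟩
      S f m + blockFrom f m (n ∸ m)  ≡⟨ sym (S-split m (n ∸ m)) ⟩
      S f (m + (n ∸ m))              ≡⟨ cong (S f) (m+[n∸m]≡n m≤n) ⟩
      S f n                          ∎
      where open ≤-Reasoning

    S-next-power : ∀ k .{{_ : NonZero k}} t → S f (k ^ suc t) ≡ S f (k ^ t) + F f k t
    S-next-power k t = begin
      S f (k ^ suc t)                    ≡⟨ cong (S f) (sym (m+[n∸m]≡n (m≤n*m (k ^ t) k))) ⟩
      S f (k ^ t + (k ^ suc t ∸ k ^ t))  ≡⟨ S-split (k ^ t) _ ⟩
      S f (k ^ t) + F f k t              ∎
      where open ≡-Reasoning

    F≤S : ∀ k .{{_ : NonZero k}} t → F f k t ≤ S f (k ^ suc t)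
    F≤S k t = ≤-trans (m≤n+m _ _) (≤-reflexive (sym (S-next-power k t)))

    -- Then  k^(t+1) ≤ 2D·F_t  and  F_t ≤ B·k^(t+1),
    -- and the blocks double at every step; the point is that S(k^t) ≤ B·k^t is at most half of k^(t+1)/D.
    module FromAverage (d B N₀ : ℕ) (avg : ∀ N → N ≥ N₀ → N ≤ suc d * S f N × S f N ≤ B * N)
                       (k : ℕ) (1<k : 1 < k) (large : 4 * suc d * B ≤ k) where
      open ≤-Reasoning
      D : ℕ
      D = suc d

      instance
        k≢0 : NonZero k
        k≢0 = >-nonZero (<-trans z<s 1<k)

      power-late : ∀ {t} → t ≥ N₀ → k ^ t ≥ N₀
      power-late {t} t≥N₀ = ≤-trans t≥N₀ (<⇒≤ (n<k^n k 1<k t))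

      block-upper : ∀ {t} → t ≥ N₀ → F f k t ≤ B * k ^ suc t
      block-upper {t} t≥N₀ = ≤-trans (F≤S k t) (proj₂ (avg _ (power-late (m≤n⇒m≤1+n t≥N₀))))

      block-lower : ∀ {t} → t ≥ N₀ → k ^ suc t ≤ 2 * D * F f k t
      block-lower {t} t≥N₀ = subst (k ^ suc t ≤_) (sym (*-assoc 2 D (F f k t)))
                               (absorb-half (k ^ suc t) (D * (B * k ^ t)) (D * F f k t) split head-small)
        where
        split : k ^ suc t ≤ D * (B * k ^ t) + D * F f k t
        split = begin
          k ^ suc t                    ≤⟨ proj₁ (avg _ (power-late (m≤n⇒m≤1+n t≥N₀))) ⟩
          D * S f (k ^ suc t)          ≡⟨ cong (D *_) (S-next-power k t) ⟩
          D * (S f (k ^ t) + F f k t)  ≡⟨ *-distribˡ-+ D (S f (k ^ t)) _ ⟩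
          D * S f (k ^ t) + D * F f k t
            ≤⟨ +-monoˡ-≤ _ (*-monoʳ-≤ D (proj₂ (avg _ (power-late t≥N₀)))) ⟩
          D * (B * k ^ t) + D * F f k t ∎
        head-small : 2 * (D * (B * k ^ t)) ≤ k ^ suc t
        head-small = begin
          2 * (D * (B * k ^ t))  ≤⟨ *-monoˡ-≤ (D * (B * k ^ t)) (s≤s (s≤s (z≤n {2}))) ⟩
          4 * (D * (B * k ^ t))  ≡⟨ reassoc D B (k ^ t) ⟩
          4 * D * B * k ^ t      ≤⟨ *-monoˡ-≤ (k ^ t) large ⟩
          k ^ suc t              ∎
          where
          reassoc : ∀ D B Y → 4 * (D * (B * Y)) ≡ 4 * D * B * Y
          reassoc = solve-∀

      block-doubling : ∀ {t} → t ≥ N₀ → 2 * F f k t ≤ F f k (suc t)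
      block-doubling {t} t≥N₀ = *-cancelˡ-≤ (2 * D) (begin
        2 * D * (2 * F f k t)  ≡⟨ reassoc D (F f k t) ⟩
        4 * D * F f k t        ≤⟨ *-monoʳ-≤ (4 * D) (block-upper t≥N₀) ⟩
        4 * D * (B * k ^ suc t) ≡⟨ sym (*-assoc (4 * D) B _) ⟩
        4 * D * B * k ^ suc t  ≤⟨ *-monoˡ-≤ (k ^ suc t) large ⟩
        k ^ suc (suc t)        ≤⟨ block-lower (m≤n⇒m≤1+n t≥N₀) ⟩
        2 * D * F f k (suc t)  ∎)
        where
        reassoc : ∀ D F → 2 * D * (2 * F) ≡ 4 * D * F
        reassoc = solve-∀

    -- Summing the upper block bounds gives S(k^t) ≤ C + B·k^t; locating N between consecutive
    -- powers k^(T+1) ≤ N < k^(T+2) then bounds S N from both sides by multiples of N.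
    module FromBlocks (k : ℕ) (1<k : 1 < k) (d B T₀ : ℕ)
                      (blk : ∀ t → t ≥ T₀ → k ^ suc t ≤ suc d * F f k t × F f k t ≤ B * k ^ t) where
      open ≤-Reasoning
      D : ℕ
      D = suc d
      C : ℕ
      C = S f (k ^ T₀)

      instance
        k≢0 : NonZero k
        k≢0 = >-nonZero (<-trans z<s 1<k)

      -- Each block adds at most B·k^t ≤ B·(k^(t+1) − k^t), so the excess over C stays ≤ B·k^t.
      S-power-upper : ∀ {t} → T₀ ≤′ t → S f (k ^ t) ≤ C + B * k ^ t
      S-power-upper (≤′-reflexive refl) = m≤m+n C _
      S-power-upper {suc t} (≤′-step T₀≤′t) = begin
        S f (k ^ suc t)                ≡⟨ S-next-power k t ⟩
        S f (k ^ t) + F f k t          ≤⟨ +-mono-≤ (S-power-upper T₀≤′t) (proj₂ (blk t (≤′⇒≤ T₀≤′t))) ⟩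
        C + B * k ^ t + B * k ^ t      ≡⟨ +-assoc C _ _ ⟩
        C + (B * k ^ t + B * k ^ t)    ≡⟨ cong (C +_) (sym (*-distribˡ-+ B (k ^ t) _)) ⟩
        C + B * (k ^ t + k ^ t)        ≡⟨ cong (λ x → C + B * (k ^ t + x)) (sym (+-identityʳ (k ^ t))) ⟩
        C + B * (2 * k ^ t)            ≤⟨ +-monoʳ-≤ C (*-monoʳ-≤ B (*-monoˡ-≤ (k ^ t) 1<k)) ⟩
        C + B * k ^ suc t              ∎

      between-powers : ∀ N T → T₀ ≤ T → N ≥ C → k ^ suc T ≤ N → N < k ^ suc (suc T) →
                       N ≤ suc (k * D) * S f N × S f N ≤ suc (B * k) * N
      between-powers N T T₀≤T N≥C lo hi = lower , upper
        where
        lower : N ≤ suc (k * D) * S f N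
        lower = begin
          N                           ≤⟨ <⇒≤ hi ⟩
          k * k ^ suc T               ≤⟨ *-monoʳ-≤ k (proj₁ (blk T T₀≤T)) ⟩
          k * (D * F f k T)           ≤⟨ *-monoʳ-≤ k (*-monoʳ-≤ D (≤-trans (F≤S k T) (S-mono lo))) ⟩
          k * (D * S f N)             ≡⟨ sym (*-assoc k D (S f N)) ⟩
          k * D * S f N               ≤⟨ m≤n+m _ (S f N) ⟩
          suc (k * D) * S f N         ∎
        upper : S f N ≤ suc (B * k) * N
        upper = begin
          S f N                       ≤⟨ S-mono (<⇒≤ hi) ⟩
          S f (k ^ suc (suc T))       ≤⟨ S-power-upper (≤⇒≤′ (m≤n⇒m≤1+n (m≤n⇒m≤1+n T₀≤T))) ⟩
          C + B * (k * k ^ suc T)     ≤⟨ +-mono-≤ N≥C (*-monoʳ-≤ B (*-monoʳ-≤ k lo)) ⟩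
          N + B * (k * N)             ≡⟨ cong (N +_) (sym (*-assoc B k N)) ⟩
          suc (B * k) * N             ∎

      average-bounds : ∀ N → N ≥ k ^ suc T₀ + C → N ≤ suc (k * D) * S f N × S f N ≤ suc (B * k) * N
      average-bounds N N≥ with bracket (k ^_) N N (suc T₀) (≤-trans (m≤m+n _ C) N≥)
                                 (<-≤-trans (n<k^n k 1<k N) (^-monoʳ-≤ k (m≤m+n N (suc T₀))))
      ... | suc T , s≤s T₀≤T , lo , hi = between-powers N T T₀≤T (≤-trans (m≤n+m C _) N≥) lo hi

    AverageOrder : Set
    AverageOrder = NatBounds (λ N → N) (S f) (λ N → N)

    BlockOrder : ℕ → Set
    BlockOrder k = NatBounds (λ t → k ^ suc t) (F f k) (k ^_)

    Doubling : ℕ → Set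
    Doubling k = Eventually λ t → 2 * F f k t ≤ F f k (suc t)

    threshold : AverageOrder → ℕ
    threshold (d , B , _) = 4 * suc d * B + 2

    1<threshold : ∀ avg → 1 < threshold avg
    1<threshold avg = m≤n+m 2 _

    average⇒blocks : (avg : AverageOrder) → ∀ k → k ≥ threshold avg → BlockOrder k × Doubling k
    -- The lower block constant is d + (suc d + 0), whose successor is 2·(1+d) as in block-lower.
    average⇒blocks avg@(d , B , N₀ , bounds) k k≥ =
      (d + (suc d + 0) , B * k , N₀ , λ t t≥N₀ →
         block-lower t≥N₀ , ≤-trans (block-upper t≥N₀) (≤-reflexive (sym (*-assoc B k (k ^ t))))) ,
      (N₀ , λ t → block-doubling)
      where open FromAverage d B N₀ bounds k (≤-trans (1<threshold avg) k≥) (≤-trans (m≤m+n _ 2) k≥)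

    blocks⇒average : ∀ k → 1 < k → BlockOrder k → AverageOrder
    blocks⇒average k 1<k (d , B , T₀ , bounds) = k * suc d , suc (B * k) , k ^ suc T₀ + C , average-bounds
      where open FromBlocks k 1<k d B T₀ bounds

module RationalBounds where
  open import Defs using (toℚ)
  open import Data.Nat as ℕ using (ℕ; zero; suc; s≤s; z≤n)
  import Data.Nat.Properties as ℕ
  open import Data.Integer as ℤ using (+_; -[1+_])
  import Data.Integer.Properties as ℤ
  open import Data.Rational using (ℚ; mkℚ; 0ℚ; 1ℚ; _≤_; _<_; _*_; toℚᵘ; *<*)
  open import Data.Rational.Properties using (normalize-coprime; toℚᵘ-mono-≤; toℚᵘ-cancel-≤; toℚᵘ-homo-*; <-trans)
  open import Data.Rational.Unnormalised using (mkℚᵘ; *≤*; _≃_) renaming (_≤_ to _≤ᵘ_; _*_ to _*ᵘ_)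
  import Data.Rational.Unnormalised.Properties as ℚᵘ
  open import Data.Nat.Coprimality using (Coprime; 1-coprimeTo; sym)
  open import Data.Product using (Σ; _×_; _,_; proj₁; proj₂)
  open import Function.Bundles using (_⇔_; mk⇔; Equivalence)
  open import Function.Properties.Equivalence using () renaming (trans to ⇔-trans)
  open import Relation.Binary.PropositionalEquality using (_≡_; cong; trans; subst; subst₂) renaming (sym to ≡-sym)
  open BlockSums using (Eventually; NatBounds)

  toℚᵘ-toℚ : ∀ x → toℚᵘ (toℚ x) ≡ mkℚᵘ (+ x) 0
  toℚᵘ-toℚ x = cong toℚᵘ (normalize-coprime (sym (1-coprimeTo x)))

  ≤⇔≤ᵘ : ∀ {a b u v} → toℚᵘ a ≃ u → toℚᵘ b ≃ v → (a ≤ b) ⇔ (u ≤ᵘ v)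
  ≤⇔≤ᵘ a≃u b≃v = mk⇔
    (λ a≤b → ℚᵘ.≤-respʳ-≃ b≃v (ℚᵘ.≤-respˡ-≃ a≃u (toℚᵘ-mono-≤ a≤b)))
    (λ u≤v → toℚᵘ-cancel-≤ (ℚᵘ.≤-respʳ-≃ (ℚᵘ.≃-sym b≃v) (ℚᵘ.≤-respˡ-≃ (ℚᵘ.≃-sym a≃u) u≤v)))

  toℚᵘ-scaled : ∀ p d .(c : Coprime p (suc d)) x →
                toℚᵘ (mkℚ (+ p) d c * toℚ x) ≃ mkℚᵘ (+ p) d *ᵘ mkℚᵘ (+ x) 0
  toℚᵘ-scaled p d c x = ℚᵘ.≃-trans (toℚᵘ-homo-* (mkℚ (+ p) d c) (toℚ x))
                                   (ℚᵘ.*-congˡ {mkℚᵘ (+ p) d} (ℚᵘ.≃-reflexive (toℚᵘ-toℚ x)))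

  -- The cross products appearing when (p/(1+d))·(x/1) is compared with y/1.
  numerator-product : ∀ p x → (+ p ℤ.* + x) ℤ.* + 1 ≡ + (p ℕ.* x)
  numerator-product p x = trans (ℤ.*-identityʳ _) (≡-sym (ℤ.pos-* p x))

  denominator-product : ∀ y d → + y ℤ.* + suc (d ℕ.* 1) ≡ + (y ℕ.* suc d)
  denominator-product y d = trans (≡-sym (ℤ.pos-* y (suc (d ℕ.* 1))))
                                  (cong (λ n → + (y ℕ.* suc n)) (ℕ.*-identityʳ d))

  scaled-≤ : ∀ p d .(c : Coprime p (suc d)) x y →
             (mkℚ (+ p) d c * toℚ x ≤ toℚ y) ⇔ (p ℕ.* x ℕ.≤ y ℕ.* suc d)
  scaled-≤ p d c x y = ⇔-trans (≤⇔≤ᵘ (toℚᵘ-scaled p d c x) (ℚᵘ.≃-reflexive (toℚᵘ-toℚ y))) (mk⇔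
    (λ { (*≤* le) → ℤ.drop‿+≤+ (subst₂ ℤ._≤_ (numerator-product p x) (denominator-product y d) le) })
    (λ le → *≤* (subst₂ ℤ._≤_ (≡-sym (numerator-product p x)) (≡-sym (denominator-product y d)) (ℤ.+≤+ le))))

  ≤-scaled : ∀ p d .(c : Coprime p (suc d)) x y →
             (toℚ y ≤ mkℚ (+ p) d c * toℚ x) ⇔ (y ℕ.* suc d ℕ.≤ p ℕ.* x)
  ≤-scaled p d c x y = ⇔-trans (≤⇔≤ᵘ (ℚᵘ.≃-reflexive (toℚᵘ-toℚ y)) (toℚᵘ-scaled p d c x)) (mk⇔
    (λ { (*≤* le) → ℤ.drop‿+≤+ (subst₂ ℤ._≤_ (denominator-product y d) (numerator-product p x) le) })
    (λ le → *≤* (subst₂ ℤ._≤_ (≡-sym (denominator-product y d)) (≡-sym (numerator-product p x)) (ℤ.+≤+ le))))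

  RatBounds : (X Y V : ℕ → ℕ) → Set
  RatBounds X Y V = Σ ℚ λ a → Σ ℚ λ b → 0ℚ < a × a < b ×
    Eventually λ N → (a * toℚ (X N) ≤ toℚ (Y N)) × (toℚ (Y N) ≤ b * toℚ (V N))

  -- Rational constants can be replaced by natural ones: a = (1+m)/(1+d) gives X ≤ (1+d)·Y,
  -- and b = q/(1+e) gives Y ≤ q·V.
  ratBounds⇒natBounds : ∀ {X Y V} → RatBounds X Y V → NatBounds X Y V
  ratBounds⇒natBounds (mkℚ (+ zero) _ _ , _ , *<* (ℤ.+<+ ()) , _)
  ratBounds⇒natBounds (mkℚ -[1+ _ ] _ _ , _ , *<* () , _)
  ratBounds⇒natBounds (mkℚ (+ suc _) _ _ , mkℚ -[1+ _ ] _ _ , 0<a , a<b , _) with <-trans 0<a a<b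
  ... | *<* ()
  ratBounds⇒natBounds {X} {Y} {V} (mkℚ (+ suc m) d c , mkℚ (+ q) e c′ , _ , _ , N₀ , bounds) =
    d , q , N₀ , λ N N≥N₀ → lower N (proj₁ (bounds N N≥N₀)) , upper N (proj₂ (bounds N N≥N₀))
    where
    lower : ∀ N → mkℚ (+ suc m) d c * toℚ (X N) ≤ toℚ (Y N) → X N ℕ.≤ suc d ℕ.* Y N
    lower N le = ℕ.≤-trans (ℕ.m≤m+n (X N) (m ℕ.* X N))
                   (ℕ.≤-trans (Equivalence.to (scaled-≤ (suc m) d c (X N) (Y N)) le)
                              (ℕ.≤-reflexive (ℕ.*-comm (Y N) (suc d))))
    upper : ∀ N → toℚ (Y N) ≤ mkℚ (+ q) e c′ * toℚ (V N) → Y N ℕ.≤ q ℕ.* V N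
    upper N le = ℕ.≤-trans (ℕ.m≤m*n (Y N) (suc e)) (Equivalence.to (≤-scaled q e c′ (V N) (Y N)) le)

  natBounds⇒ratBounds : ∀ {X Y V} → NatBounds X Y V → RatBounds X Y V
  natBounds⇒ratBounds {X} {Y} {V} (d , B , N₀ , bounds) =
    mkℚ (+ 1) d (1-coprimeTo (suc d)) , mkℚ (+ suc (suc B)) 0 (sym (1-coprimeTo (suc (suc B)))) ,
    *<* (ℤ.+<+ (s≤s z≤n)) , *<* (ℤ.+<+ (s≤s (ℕ.≤-trans (s≤s z≤n) (ℕ.m≤n+m _ d)))) , N₀ ,
    λ N N≥N₀ → lower N (proj₁ (bounds N N≥N₀)) , upper N (proj₂ (bounds N N≥N₀))
    where
    lower : ∀ N → X N ℕ.≤ suc d ℕ.* Y N → mkℚ (+ 1) d _ * toℚ (X N) ≤ toℚ (Y N)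
    lower N le = Equivalence.from (scaled-≤ 1 d _ (X N) (Y N))
                   (subst₂ ℕ._≤_ (≡-sym (ℕ.*-identityˡ (X N))) (ℕ.*-comm (suc d) (Y N)) le)
    upper : ∀ N → Y N ℕ.≤ B ℕ.* V N → toℚ (Y N) ≤ mkℚ (+ suc (suc B)) 0 _ * toℚ (V N)
    upper N le = Equivalence.from (≤-scaled (suc (suc B)) 0 _ (V N) (Y N))
                   (subst (ℕ._≤ _) (≡-sym (ℕ.*-identityʳ (Y N)))
                     (ℕ.≤-trans le (ℕ.*-monoˡ-≤ (V N) (ℕ.m≤n+m B 2))))

  ratBounds⇔natBounds : ∀ {X Y V} → RatBounds X Y V ⇔ NatBounds X Y V
  ratBounds⇔natBounds = mk⇔ ratBounds⇒natBounds natBounds⇒ratBounds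

  doubling⇒ratio : (g : ℕ → ℕ) → Eventually (λ t → 2 ℕ.* g t ℕ.≤ g (suc t)) →
                   Σ ℚ λ l → 0ℚ < l × l < 1ℚ × Eventually λ t → toℚ (g t) ≤ l * toℚ (g (suc t))
  doubling⇒ratio g (T₁ , doubles) = mkℚ (+ 1) 1 (1-coprimeTo 2) , *<* (ℤ.+<+ (s≤s z≤n)) , *<* (ℤ.+<+ (s≤s (s≤s z≤n))) ,
    T₁ , λ t t≥T₁ → Equivalence.from (≤-scaled 1 1 _ (g (suc t)) (g t))
                      (subst₂ ℕ._≤_ (ℕ.*-comm 2 (g t)) (≡-sym (ℕ.*-identityˡ (g (suc t)))) (doubles t t≥T₁))

open import Defs
open import Data.Nat using (ℕ; suc; _^_; _≥_) renaming (_≤_ to _≤ℕ_; _<_ to _<ℕ_)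
open import Data.Nat.Properties using (≤-refl)
open import Data.Rational using (ℚ; 0ℚ; 1ℚ; _≤_; _<_; _*_)
open import Data.Product using (Σ; _×_; _,_; proj₁)
open import Function.Bundles using (_⇔_; mk⇔)
open BlockSums using (Eventually; AverageOrder; BlockOrder; Doubling; threshold; 1<threshold; average⇒blocks; blocks⇒average)
open RationalBounds using (RatBounds; ratBounds⇒natBounds; natBounds⇒ratBounds; doubling⇒ratio)

lemma6p1 : (f : ℕ → ℕ) → (∀ n → f n ≤ℕ n) →
    ((Σ ℚ λ a → Σ ℚ λ b → 0ℚ < a × a < b × Σ ℕ λ N₀ → ∀ N → N ≥ N₀ →
        (a * toℚ N ≤ toℚ (S f N)) × (toℚ (S f N) ≤ b * toℚ N))
      ⇔
     (Σ ℕ λ k → 1 <ℕ k × Σ ℚ λ a′ → Σ ℚ λ b′ → 0ℚ < a′ × a′ < b′ × Σ ℕ λ T₀ → ∀ t → t ≥ T₀ →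
        (a′ * toℚ (k ^ suc t) ≤ toℚ (F f k t)) × (toℚ (F f k t) ≤ b′ * toℚ (k ^ t))))
    ×
    ((Σ ℚ λ a → Σ ℚ λ b → 0ℚ < a × a < b × Σ ℕ λ N₀ → ∀ N → N ≥ N₀ →
        (a * toℚ N ≤ toℚ (S f N)) × (toℚ (S f N) ≤ b * toℚ N))
      →
     Σ ℕ λ K → ∀ k → k ≥ K → 1 <ℕ k →
       (Σ ℚ λ a′ → Σ ℚ λ b′ → 0ℚ < a′ × a′ < b′ × Σ ℕ λ T₀ → ∀ t → t ≥ T₀ →
          (a′ * toℚ (k ^ suc t) ≤ toℚ (F f k t)) × (toℚ (F f k t) ≤ b′ * toℚ (k ^ t)))
       × (Σ ℚ λ l → 0ℚ < l × l < 1ℚ × Σ ℕ λ T₁ → ∀ t → t ≥ T₁ →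
          toℚ (F f k t) ≤ l * toℚ (F f k (suc t))))
lemma6p1 f _ = mk⇔ toBlocks fromBlocks , largeBases
  where
  Average : Set
  Average = RatBounds (λ N → N) (S f) (λ N → N)

  Blocks : ℕ → Set
  Blocks k = RatBounds (λ t → k ^ suc t) (F f k) (k ^_)

  Ratio : ℕ → Set
  Ratio k = Σ ℚ λ l → 0ℚ < l × l < 1ℚ × Eventually λ t → toℚ (F f k t) ≤ l * toℚ (F f k (suc t))

  largeBases : Average → Σ ℕ λ K → ∀ k → k ≥ K → 1 <ℕ k → Blocks k × Ratio k
  largeBases average = threshold f avg , λ k k≥K _ → blocksAndRatio k (average⇒blocks f avg k k≥K)
    where
    avg : AverageOrder f
    avg = ratBounds⇒natBounds average
    blocksAndRatio : ∀ k → BlockOrder f k × Doubling f k → Blocks k × Ratio k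
    blocksAndRatio k (blocks , doubling) = natBounds⇒ratBounds blocks , doubling⇒ratio (F f k) doubling

  toBlocks : Average → Σ ℕ λ k → 1 <ℕ k × Blocks k
  toBlocks average =
    threshold f avg , 1<threshold f avg , natBounds⇒ratBounds (proj₁ (average⇒blocks f avg (threshold f avg) ≤-refl))
    where
    avg : AverageOrder f
    avg = ratBounds⇒natBounds average

  fromBlocks : (Σ ℕ λ k → 1 <ℕ k × Blocks k) → Average
  fromBlocks (k , 1<k , blocks) = natBounds⇒ratBounds (blocks⇒average f k 1<k (ratBounds⇒natBounds blocks))
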